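{- Let $f(x,y)=(y^2-x^3)/x$. For a fourth-power-free integer $Q\geq 2$ let $C_{Q}=\{a\in\mathbb{N}_{+}:\ \mathcal{G}(a,Q)\subset\mathcal{V}_{f}\}$. Then $\bigcap_{Q\geq 2,\ Q\text{ fourth-power-free}}C_{Q}=\emptyset$; that is, there is no positive integer $a$ such that $\mathcal{G}(a,Q)\subset\mathcal{V}_{f}$ for every fourth-power-free integer $Q\geq 2$.
   Context: For $a,Q\in\mathbb{Q}$ with $aQ(Q^2-1)\neq 0$, $\mathcal{G}(a,Q)=\{aQ^{i}:\ i\in\mathbb{N}\}$, where $\mathbb{N}=\{0,1,2,\dots\}$. For $f\in\mathbb{Q}(x,y)$, $\mathcal{V}_{f}=\{f(u,v):\ u,v\in\mathbb{Q}\text{ such that }f(u,v)\text{ is defined}\}$. -}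

module Defs where

open import Data.Nat as ℕ using (ℕ; _^_; _≥_)
open import Data.Nat.Divisibility using (_∣_)
open import Data.Rational as ℚ using (ℚ; 0ℚ; _*_; _-_; _÷_; ≢-nonZero)
open import Data.Integer using (+_)
open import Data.Product using (Σ; ∃; ∃-syntax; _×_)
open import Relation.Binary.PropositionalEquality using (_≡_; _≢_)

f : (u v : ℚ) → u ≢ 0ℚ → ℚ
f u v u≢0 = _÷_ (v * v - u * u * u) u {{≢-nonZero u≢0}}

InVf : ℚ → Set
InVf r = ∃[ u ] ∃[ v ] Σ (u ≢ 0ℚ) (λ u≢0 → f u v u≢0 ≡ r)

toℚ : ℕ → ℚ
toℚ n = ℚ._/_ (+ n) 1

GeomInVf : ℕ → ℕ → Set
GeomInVf a Q = ∀ (i : ℕ) → InVf (toℚ (a ℕ.* Q ^ i))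

FourthPowerFree : ℕ → Set
FourthPowerFree Q = ∀ (d : ℕ) → d ^ 4 ∣ Q → d ≡ 1

{-# OPTIONS --safe #-}
-- Write a = s t⁴ with s fourth-power-free; for Q = 2 (if s = 1) or Q = s (otherwise) some
-- term a Qⁱ of the progression is a fourth power c⁴. A point (u, v) with (v² − u³)/u = c⁴
-- rescales to (u/c², v/c³) on v² = u³ + u with u ≠ 0. Writing u = p/q and v = r/s in lowest
-- terms, r² q³ = s² p (p² + q²) forces s² = q³, so q = k², and r² = p (p² + k⁴) with coprime
-- factors, so p = a² and p² + k⁴ = c². Then a⁴ + k⁴ = c², which Fermat's descent excludes:
-- from a primitive solution, two applications of the parametrisation of primitive
-- Pythagorean triples produce another one with smaller z.
module Submission where

open import Defs
open import Data.Nat using (ℕ; zero; suc; _+_; _*_; _^_; _≤_; _<_; _≥_; _>_; z≤n; s≤s; z<s; s<s; NonZero; >-nonZero; >-nonZero⁻¹; ≢-nonZero; _≤?_; _∸_)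
open import Data.Nat.Properties
open import Data.Nat.Divisibility
open import Data.Nat.DivMod using (_/_; _%_; m/n*n≡m; [m+kn]%n≡m%n; m<n⇒m%n≡m)
open import Data.Nat.GCD using (gcd; gcd[m,n]∣m; gcd[m,n]∣n; gcd-greatest; gcd[m,n]≢0; c*gcd[m,n]≡gcd[cm,cn])
open import Data.Nat.Coprimality as Coprime using (Coprime; coprime-divisor; coprime-/gcd)
open import Data.Nat.Induction using (<-rec)
open import Data.Nat.Tactic.RingSolver using (solve-∀; solve)
open import Data.List using (_∷_; [])
open import Data.Product using (∃; ∃₂; ∃-syntax; _×_; _,_)
open import Data.Sum using (_⊎_; inj₁; inj₂)
open import Data.Empty using (⊥; ⊥-elim)
open import Relation.Nullary using (¬_; yes; no)
open import Relation.Nullary.Decidable using (_×-dec_)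
open import Relation.Binary.Definitions using (tri<; tri≈; tri>)
open import Relation.Binary.PropositionalEquality
open import Data.Integer as ℤ using (+[1+_]; ∣_∣)
import Data.Integer.Properties as ℤP
import Data.Integer.Tactic.RingSolver as ℤSolver
open import Data.Rational as ℚ using (mkℚ; 0ℚ; 1ℚ; 1/_; toℚᵘ)
open import Data.Rational.Solver using (module +-*-Solver)
import Data.Rational.Properties as ℚP
open import Data.Rational.Unnormalised as ℚᵘ using (*≡*)
import Data.Rational.Unnormalised.Properties as ℚᵘP

private
  variable
    a b c d m n p q r s u v w x y z : ℕ

-- Squares and coprimality

m*n>0⇒m>0 : m * n > 0 → m > 0
m*n>0⇒m>0 {suc _} _ = z<s

m*n>0⇒n>0 : m * n > 0 → n > 0
m*n>0⇒n>0 {m} {n} mn>0 = m*n>0⇒m>0 (subst (_> 0) (*-comm m n) mn>0)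

m≤m*m : ∀ m → m ≤ m * m
m≤m*m zero    = z≤n
m≤m*m (suc m) = m≤m*n (suc m) (suc m)

coprime-∣ˡ : d ∣ a → Coprime a b → Coprime d b
coprime-∣ˡ d∣a a⊥b (e∣d , e∣b) = a⊥b (∣-trans e∣d d∣a , e∣b)

coprime-*ʳ : Coprime a b → Coprime a c → Coprime a (b * c)
coprime-*ʳ a⊥b a⊥c (d∣a , d∣bc) = a⊥c (d∣a , coprime-divisor (coprime-∣ˡ d∣a a⊥b) d∣bc)

coprime-*ˡ : Coprime a c → Coprime b c → Coprime (a * b) c
coprime-*ˡ a⊥c b⊥c = Coprime.sym (coprime-*ʳ (Coprime.sym a⊥c) (Coprime.sym b⊥c))

coprime-square : Coprime a b → Coprime (a * a) (b * b)
coprime-square a⊥b = coprime-*ˡ a⊥bb a⊥bb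
  where a⊥bb = coprime-*ʳ a⊥b a⊥b

square-*-distrib : ∀ m n → m * n * (m * n) ≡ m * m * (n * n)
square-*-distrib = solve-∀

square-injective : m * m ≡ n * n → m ≡ n
square-injective {m} {n} eq with <-cmp m n
... | tri< m<n _ _ = ⊥-elim (<-irrefl eq (*-mono-< m<n m<n))
... | tri≈ _ m≡n _ = m≡n
... | tri> _ _ n<m = ⊥-elim (<-irrefl (sym eq) (*-mono-< n<m n<m))

square-∣-square⇒∣ : m * m ∣ n * n → m ∣ n
square-∣-square⇒∣ {zero} {n} 0∣nn with m*n≡0⇒m≡0∨n≡0 n (0∣⇒≡0 0∣nn)
... | inj₁ refl = ∣-refl
... | inj₂ refl = ∣-refl
square-∣-square⇒∣ {m@(suc _)} {n} mm∣nn = subst (_∣ n) (sym m≡g) (gcd[m,n]∣n m n)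
  where
  g = gcd m n
  instance
    g≢0 : NonZero g
    g≢0 = ≢-nonZero (gcd[m,n]≢0 m n (inj₁ (λ ())))
  m′ = m / g
  n′ = n / g
  square-split : ∀ {k} → g ∣ k → k * k ≡ k / g * (k / g) * (g * g)
  square-split {k} g∣k = trans (cong (λ x → x * x) (sym (m/n*n≡m g∣k))) (square-*-distrib (k / g) g)
  m′m′∣n′n′ : m′ * m′ ∣ n′ * n′
  m′m′∣n′n′ = *-cancelʳ-∣ (g * g) {{m*n≢0 g g}}
    (subst₂ _∣_ (square-split (gcd[m,n]∣m m n)) (square-split (gcd[m,n]∣n m n)) mm∣nn)
  m′≡1 : m′ ≡ 1
  m′≡1 = m*n≡1⇒m≡1 m′ m′ (coprime-square (coprime-/gcd m n) (∣-refl , m′m′∣n′n′))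
  m≡g : m ≡ g
  m≡g = begin
    m          ≡⟨ sym (m/n*n≡m (gcd[m,n]∣m m n)) ⟩
    m′ * g     ≡⟨ cong (_* g) m′≡1 ⟩
    1 * g      ≡⟨ *-identityˡ g ⟩
    g          ∎
    where open ≡-Reasoning

coprime-*≡square⇒squares : Coprime u v → u * v ≡ w * w →
                           ∃₂ λ m n → u ≡ m * m × v ≡ n * n × w ≡ m * n
coprime-*≡square⇒squares {u} {v} {w} u⊥v uv≡ww =
  gcd u w , gcd v w , u≡gg , v≡gg , square-injective w≡gg*gg
  where
  -- With g = gcd u w: u ∣ gcd (w u) (w w) = w g, hence u ∣ gcd (g u) (g w) = g²;
  -- conversely g² ∣ w² = v u and g² ⊥ v.
  left-square : ∀ {u v} → Coprime u v → u * v ≡ w * w → u ≡ gcd u w * gcd u w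
  left-square {u} {v} u⊥v uv≡ww = ∣-antisym u∣gg gg∣u
    where
    g = gcd u w
    u∣wg : u ∣ w * g
    u∣wg = subst (u ∣_) (sym (c*gcd[m,n]≡gcd[cm,cn] w u w))
             (gcd-greatest (n∣m*n w) (subst (u ∣_) uv≡ww (m∣m*n v)))
    u∣gg : u ∣ g * g
    u∣gg = subst (u ∣_) (sym (c*gcd[m,n]≡gcd[cm,cn] g u w))
             (gcd-greatest (n∣m*n g) (subst (u ∣_) (*-comm w g) u∣wg))
    gg∣vu : g * g ∣ v * u
    gg∣vu = subst (g * g ∣_) (trans (sym uv≡ww) (*-comm u v))
              (*-pres-∣ (gcd[m,n]∣n u w) (gcd[m,n]∣n u w))
    g⊥v : Coprime g v
    g⊥v = coprime-∣ˡ (gcd[m,n]∣m u w) u⊥v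
    gg∣u : g * g ∣ u
    gg∣u = coprime-divisor (coprime-*ˡ g⊥v g⊥v) gg∣vu
  u≡gg : u ≡ gcd u w * gcd u w
  u≡gg = left-square u⊥v uv≡ww
  v≡gg : v ≡ gcd v w * gcd v w
  v≡gg = left-square (Coprime.sym u⊥v) (trans (*-comm v u) uv≡ww)
  w≡gg*gg : w * w ≡ gcd u w * gcd v w * (gcd u w * gcd v w)
  w≡gg*gg = trans (sym uv≡ww) (trans (cong₂ _*_ u≡gg v≡gg) (sym (square-*-distrib (gcd u w) (gcd v w))))

square≡cube⇒square : m * m ≡ n * n * n → ∃ λ k → n ≡ k * k
square≡cube⇒square {m} {zero} _ = 0 , refl
square≡cube⇒square {m} {n@(suc _)} mm≡nnn = k , sym kk≡n
  where
  n∣m : n ∣ m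
  n∣m = square-∣-square⇒∣ (divides n (trans mm≡nnn (*-comm (n * n) n)))
  k = quotient n∣m
  kk≡n : k * k ≡ n
  kk≡n = *-cancelʳ-≡ (k * k) n (n * n) {{m*n≢0 n n}} (begin
    k * k * (n * n)   ≡⟨ sym (square-*-distrib k n) ⟩
    k * n * (k * n)   ≡⟨ cong (λ x → x * x) (sym (_∣_.equality n∣m)) ⟩
    m * m             ≡⟨ mm≡nnn ⟩
    n * n * n         ≡⟨ *-comm (n * n) n ⟩
    n * (n * n)       ∎)
    where open ≡-Reasoning

-- Parity

Even Odd : ℕ → Set
Even n = ∃ λ k → n ≡ 2 * k
Odd  n = ∃ λ k → n ≡ 1 + 2 * k

even⊎odd : ∀ n → Even n ⊎ Odd n
even⊎odd zero = inj₁ (0 , refl)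
even⊎odd (suc n) with even⊎odd n
... | inj₁ (k , refl) = inj₂ (k , refl)
... | inj₂ (k , refl) = inj₁ (suc k , solve (k ∷ []))

remainder-unique : ∀ {q q′ r r′} k .{{_ : NonZero k}} →
                   r + q * k ≡ r′ + q′ * k → r < k → r′ < k → r ≡ r′
remainder-unique {q} {q′} {r} {r′} k eq r<k r′<k = begin
  r                 ≡⟨ sym (m<n⇒m%n≡m r<k) ⟩
  r % k             ≡⟨ sym ([m+kn]%n≡m%n r q k) ⟩
  (r + q * k) % k   ≡⟨ cong (_% k) eq ⟩
  (r′ + q′ * k) % k ≡⟨ [m+kn]%n≡m%n r′ q′ k ⟩
  r′ % k            ≡⟨ m<n⇒m%n≡m r′<k ⟩
  r′                ∎
  where open ≡-Reasoning

even⇒¬odd : Even n → ¬ Odd n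
even⇒¬odd (k , refl) (l , eq)
  with remainder-unique {k} {l} 2 (trans (*-comm k 2) (trans eq (cong suc (*-comm 2 l)))) z<s (s<s z<s)
... | ()

even-square : Even n → ∃ λ k → n * n ≡ 4 * k
even-square (k , refl) = k * k , solve (k ∷ [])

odd-square : Odd n → ∃ λ k → n * n ≡ 1 + 4 * k
odd-square (k , refl) = k * k + k , solve (k ∷ [])

odd⇒odd-square : Odd n → Odd (n * n)
odd⇒odd-square n-odd with odd-square n-odd
... | k , eq = 2 * k , trans eq (solve (k ∷ []))

even⇒even-square : Even n → Even (n * n)
even⇒even-square n-even with even-square n-even
... | k , eq = 2 * k , trans eq (solve (k ∷ []))

odd-square⇒odd : Odd (n * n) → Odd n
odd-square⇒odd {n} nn-odd with even⊎odd n
... | inj₁ n-even = ⊥-elim (even⇒¬odd (even⇒even-square n-even) nn-odd)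
... | inj₂ n-odd  = n-odd

square≢2-mod-4 : ∀ q → 2 + q * 4 ≢ z * z
square≢2-mod-4 {z} q eq with even⊎odd z
... | inj₁ z-even with even-square z-even
...   | j , zz≡ with remainder-unique {q} {j} 4 (trans eq (trans zz≡ (*-comm 4 j))) (s<s (s<s z<s)) z<s
...     | ()
square≢2-mod-4 {z} q eq | inj₂ z-odd with odd-square z-odd
...   | j , zz≡ with remainder-unique {q} {j} 4 (trans eq (trans zz≡ (cong suc (*-comm 4 j)))) (s<s (s<s z<s)) (s<s z<s)
...     | ()

odd-squares-sum≢square : Odd x → Odd y → x * x + y * y ≢ z * z
odd-squares-sum≢square {z = z} x-odd y-odd eq with odd-square x-odd | odd-square y-odd
... | k , xx≡ | l , yy≡ = square≢2-mod-4 {z} (k + l) (trans regroup (trans (sym (cong₂ _+_ xx≡ yy≡)) eq))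
  where
  regroup : 2 + (k + l) * 4 ≡ (1 + 4 * k) + (1 + 4 * l)
  regroup = solve (k ∷ l ∷ [])

odd+even⇒odd : Odd m → Even n → Odd (m + n)
odd+even⇒odd (k , refl) (l , refl) = k + l , solve (k ∷ l ∷ [])

odd+odd⇒even : Odd m → Odd n → Even (m + n)
odd+odd⇒even (k , refl) (l , refl) = suc (k + l) , solve (k ∷ l ∷ [])

odd-gap : Odd m → Odd n → m ≤ n → ∃ λ h → n ≡ m + 2 * h
odd-gap {m} {n} m-odd n-odd m≤n with even⊎odd (n ∸ m)
... | inj₁ (h , eq) = h , trans (sym (m+[n∸m]≡n m≤n)) (cong (m +_) eq)
... | inj₂ gap-odd  = ⊥-elim (even⇒¬odd (subst Even (m+[n∸m]≡n m≤n) (odd+odd⇒even m-odd gap-odd)) n-odd)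

square-mono-≤⁻¹ : m * m ≤ n * n → m ≤ n
square-mono-≤⁻¹ {m} {n} mm≤nn with m ≤? n
... | yes m≤n = m≤n
... | no  m≰n = ⊥-elim (<⇒≱ (*-mono-< (≰⇒> m≰n) (≰⇒> m≰n)) mm≤nn)

pythagorean-gap : Odd a → Even b → a * a + b * b ≡ c * c → ∃ λ h → c ≡ a + 2 * h
pythagorean-gap {a} {b} {c} a-odd b-even eq = odd-gap a-odd c-odd a≤c
  where
  c-odd : Odd c
  c-odd = odd-square⇒odd (subst Odd eq (odd+even⇒odd (odd⇒odd-square a-odd) (even⇒even-square b-even)))
  a≤c : a ≤ c
  a≤c = square-mono-≤⁻¹ (≤-trans (m≤m+n (a * a) (b * b)) (≤-reflexive eq))

-- The parametrisation a = m² − n², b = 2mn, c = m² + n², stated without subtraction.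
primitive-pythagorean-triple :
  Coprime a b → Odd a → Even b → a * a + b * b ≡ c * c →
  ∃₂ λ m n → a + n * n ≡ m * m × c ≡ m * m + n * n × b ≡ 2 * (m * n) × Coprime m n
primitive-pythagorean-triple {a} {b} {c} a⊥b a-odd b-even@(b′ , refl) eq =
  from-gap (pythagorean-gap a-odd b-even eq)
  where
  a⊥c : Coprime a c
  a⊥c {d} (d∣a , d∣c) = coprime-*ʳ a⊥b a⊥b
    (d∣a , ∣m+n∣m⇒∣n (subst (d ∣_) (sym eq) (∣m⇒∣m*n c d∣c)) (∣m⇒∣m*n a d∣a))
  a+h⊥h : ∀ {h} → c ≡ a + 2 * h → Coprime (a + h) h
  a+h⊥h {h} c≡a+2h {d} (d∣a+h , d∣h) =
    a⊥c (d∣a , subst (d ∣_) (sym c≡a+2h) (∣m∣n⇒∣m+n d∣a (∣n⇒∣m*n 2 d∣h)))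
    where
    d∣a : d ∣ a
    d∣a = ∣m+n∣m⇒∣n (subst (d ∣_) (+-comm a h) d∣a+h) d∣h
  [a+h]h≡b′b′ : ∀ {h} → c ≡ a + 2 * h → (a + h) * h ≡ b′ * b′
  [a+h]h≡b′b′ {h} c≡a+2h = *-cancelˡ-≡ _ _ 4 (+-cancelˡ-≡ (a * a) _ _ (begin
    a * a + 4 * ((a + h) * h)  ≡⟨ solve (a ∷ h ∷ []) ⟩
    (a + 2 * h) * (a + 2 * h)  ≡⟨ cong (λ x → x * x) (sym c≡a+2h) ⟩
    c * c                      ≡⟨ sym eq ⟩
    a * a + 2 * b′ * (2 * b′)  ≡⟨ solve (a ∷ b′ ∷ []) ⟩
    a * a + 4 * (b′ * b′)      ∎))
    where open ≡-Reasoning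
  from-gap : (∃ λ h → c ≡ a + 2 * h) →
             ∃₂ λ m n → a + n * n ≡ m * m × c ≡ m * m + n * n × 2 * b′ ≡ 2 * (m * n) × Coprime m n
  from-gap (h , c≡a+2h) with coprime-*≡square⇒squares {w = b′} (a+h⊥h c≡a+2h) ([a+h]h≡b′b′ c≡a+2h)
  ... | m , n , a+h≡mm , h≡nn , b′≡mn =
    m , n , trans (cong (a +_) (sym h≡nn)) a+h≡mm
          , c≡mm+nn , cong (2 *_) b′≡mn
          , λ {d} (d∣m , d∣n) → a+h⊥h c≡a+2h ( subst (d ∣_) (sym a+h≡mm) (∣m⇒∣m*n m d∣m)
                                             , subst (d ∣_) (sym h≡nn) (∣m⇒∣m*n n d∣n))
    where
    open ≡-Reasoning
    c≡mm+nn : c ≡ m * m + n * n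
    c≡mm+nn = begin
      c             ≡⟨ c≡a+2h ⟩
      a + 2 * h     ≡⟨ solve (a ∷ h ∷ []) ⟩
      (a + h) + h   ≡⟨ cong₂ _+_ a+h≡mm h≡nn ⟩
      m * m + n * n ∎

-- Fermat's descent for x⁴ + y⁴ = z²

PrimitiveSolution : ℕ → Set
PrimitiveSolution z = ∃₂ λ x y → Coprime x y × x > 0 × y > 0 × x * x * (x * x) + y * y * (y * y) ≡ z * z

descent-squares : Coprime r s → Coprime m (r * s) → m * (r * s) ≡ y * y → m ≡ r * r + s * s → r * s > 0 →
                  ∃ λ z′ → z′ * z′ ≡ m × PrimitiveSolution z′
descent-squares {r} {s} {m} {y} r⊥s m⊥rs m·rs≡yy m≡rr+ss rs>0 with coprime-*≡square⇒squares {w = y} m⊥rs m·rs≡yy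
... | z′ , t , m≡z′z′ , rs≡tt , _ with coprime-*≡square⇒squares {w = t} r⊥s rs≡tt
... | x′ , w , r≡x′x′ , s≡ww , _ =
  z′ , sym m≡z′z′ , x′ , w , x′⊥w , x′>0 , w>0 , quartic
  where
  quartic : x′ * x′ * (x′ * x′) + w * w * (w * w) ≡ z′ * z′
  quartic = begin
    x′ * x′ * (x′ * x′) + w * w * (w * w) ≡⟨ cong₂ (λ a b → a * a + b * b) (sym r≡x′x′) (sym s≡ww) ⟩
    r * r + s * s                         ≡⟨ sym m≡rr+ss ⟩
    m                                     ≡⟨ m≡z′z′ ⟩
    z′ * z′                               ∎
    where open ≡-Reasoning
  x′⊥w : Coprime x′ w
  x′⊥w = coprime-∣ˡ (divides x′ r≡x′x′) (Coprime.sym (coprime-∣ˡ (divides w s≡ww) (Coprime.sym r⊥s)))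
  x′>0 : x′ > 0
  x′>0 = m*n>0⇒m>0 (subst (_> 0) r≡x′x′ (m*n>0⇒m>0 rs>0))
  w>0 : w > 0
  w>0 = m*n>0⇒m>0 (subst (_> 0) s≡ww (m*n>0⇒n>0 {r} rs>0))

descent-second-triple :
  Odd x → Coprime x n → Coprime m n → Even n → n > 0 → Even y →
  x * x + n * n ≡ m * m → y * y ≡ 2 * (m * n) →
  ∃ λ z′ → z′ * z′ ≡ m × PrimitiveSolution z′
descent-second-triple {x} {n} {m} x-odd x⊥n m⊥n n-even n>0 (y₀ , refl) xx+nn≡mm yy≡2mn
  with primitive-pythagorean-triple x⊥n x-odd n-even xx+nn≡mm
... | r , s , _ , m≡rr+ss , n≡2rs , r⊥s = descent-squares {y = y₀} r⊥s m⊥rs m·rs≡y₀y₀ m≡rr+ss rs>0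
  where
  m⊥rs : Coprime m (r * s)
  m⊥rs {d} (d∣m , d∣rs) = m⊥n (d∣m , subst (d ∣_) (sym n≡2rs) (∣n⇒∣m*n 2 d∣rs))
  m·rs≡y₀y₀ : m * (r * s) ≡ y₀ * y₀
  m·rs≡y₀y₀ = *-cancelˡ-≡ _ _ 4 (begin
    4 * (m * (r * s))       ≡⟨ solve (m ∷ r ∷ s ∷ []) ⟩
    2 * (m * (2 * (r * s))) ≡⟨ cong (λ k → 2 * (m * k)) (sym n≡2rs) ⟩
    2 * (m * n)             ≡⟨ sym yy≡2mn ⟩
    2 * y₀ * (2 * y₀)       ≡⟨ solve (y₀ ∷ []) ⟩
    4 * (y₀ * y₀)           ∎)
    where open ≡-Reasoning
  rs>0 : r * s > 0
  rs>0 = m*n>0⇒n>0 {2} (subst (_> 0) n≡2rs n>0)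

descent-odd-even : Coprime x y → Odd x → Even y → y > 0 → x * x * (x * x) + y * y * (y * y) ≡ z * z →
                   ∃ λ z′ → z′ < z × PrimitiveSolution z′
descent-odd-even {x} {y} {z} x⊥y x-odd y-even y>0 eq
  with primitive-pythagorean-triple (coprime-square x⊥y) (odd⇒odd-square x-odd) (even⇒even-square y-even) eq
... | m , n , xx+nn≡mm , z≡mm+nn , yy≡2mn , m⊥n =
  let z′ , z′z′≡m , solution = descent-second-triple x-odd x⊥n m⊥n n-even n>0 y-even xx+nn≡mm yy≡2mn
  in z′ , z′<z z′z′≡m , solution
  where
  n>0 : n > 0
  n>0 = n≢0⇒n>0 λ { refl → n>0⇒n≢0 (*-mono-< y>0 y>0) (trans yy≡2mn (cong (2 *_) (*-zeroʳ m))) }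
  n-even : Even n
  n-even with even⊎odd n
  ... | inj₁ n-even = n-even
  ... | inj₂ n-odd  = ⊥-elim (odd-squares-sum≢square {z = m} x-odd n-odd xx+nn≡mm)
  x⊥n : Coprime x n
  x⊥n {d} (d∣x , d∣n) = coprime-*ʳ d⊥m d⊥m
    (∣-refl , subst (d ∣_) xx+nn≡mm (∣m∣n⇒∣m+n (∣m⇒∣m*n x d∣x) (∣m⇒∣m*n n d∣n)))
    where
    d⊥m : Coprime d m
    d⊥m = coprime-∣ˡ d∣n (Coprime.sym m⊥n)
  z′<z : ∀ {z′} → z′ * z′ ≡ m → z′ < z
  z′<z {z′} z′z′≡m = begin-strict
    z′            ≤⟨ m≤m*m z′ ⟩
    z′ * z′       ≡⟨ z′z′≡m ⟩
    m             ≤⟨ m≤m*m m ⟩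
    m * m         <⟨ m<m+n (m * m) (*-mono-< n>0 n>0) ⟩
    m * m + n * n ≡⟨ sym z≡mm+nn ⟩
    z             ∎
    where open ≤-Reasoning

descent : Coprime x y → x > 0 → y > 0 → x * x * (x * x) + y * y * (y * y) ≡ z * z →
          ∃ λ z′ → z′ < z × PrimitiveSolution z′
descent {x} {y} x⊥y x>0 y>0 eq with even⊎odd x | even⊎odd y
... | inj₁ (i , refl) | inj₁ (j , refl) with x⊥y (divides i (*-comm 2 i) , divides j (*-comm 2 j))
...   | ()
descent {z = z} x⊥y x>0 y>0 eq | inj₂ x-odd | inj₂ y-odd =
  ⊥-elim (odd-squares-sum≢square {z = z} (odd⇒odd-square x-odd) (odd⇒odd-square y-odd) eq)
descent x⊥y x>0 y>0 eq | inj₂ x-odd | inj₁ y-even = descent-odd-even x⊥y x-odd y-even y>0 eq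
descent {x} {y} x⊥y x>0 y>0 eq | inj₁ x-even | inj₂ y-odd =
  descent-odd-even (Coprime.sym x⊥y) y-odd x-even x>0 (trans (+-comm _ (x * x * (x * x))) eq)

no-primitive-solution : ∀ z → ¬ PrimitiveSolution z
no-primitive-solution = <-rec _ λ z rec (x , y , x⊥y , x>0 , y>0 , eq) →
  let z′ , z′<z , solution = descent x⊥y x>0 y>0 eq in rec z′<z solution

-- Rational points on v² = u³ + u

lowest-terms-unique : .{{_ : NonZero u}} → Coprime m n → Coprime v u → m * u ≡ n * v → n ≡ u × m ≡ v
lowest-terms-unique {u} {m} {n} {v} m⊥n v⊥u mu≡nv =
  n≡u , *-cancelʳ-≡ m v u (trans mu≡nv (trans (cong (_* v) n≡u) (*-comm u v)))
  where
  n≡u : n ≡ u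
  n≡u = ∣-antisym (coprime-divisor (Coprime.sym m⊥n) (divides v (trans mu≡nv (*-comm n v))))
                  (coprime-divisor (Coprime.sym v⊥u) (divides m (trans (*-comm v n) (sym mu≡nv))))

-- (r/s)² = (p/q)³ + p/q with both fractions in lowest terms, denominators cleared.
no-lowest-terms-curve-point : p > 0 → q > 0 → Coprime p q → Coprime r s →
                              r * r * (q * q * q) ≢ s * s * (p * (p * p + q * q))
no-lowest-terms-curve-point {p} {q@(suc _)} {r} {s} p>0 q>0 p⊥q r⊥s eq =
  let ss≡qqq , rr≡X = lowest-terms-unique {{m*n≢0 (q * q) q}} (coprime-square r⊥s) (Coprime.sym qqq⊥X) eq
      k , q≡kk = square≡cube⇒square {s} {q} ss≡qqq
  in from-square-root {k} q≡kk rr≡X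
  where
  X = p * (p * p + q * q)
  q⊥X : Coprime q X
  q⊥X = coprime-*ʳ q⊥p λ {d} (d∣q , d∣pp+qq) → coprime-*ʳ q⊥p q⊥p
    (d∣q , ∣m+n∣m⇒∣n (subst (d ∣_) (+-comm (p * p) (q * q)) d∣pp+qq) (∣m⇒∣m*n q d∣q))
    where
    q⊥p : Coprime q p
    q⊥p = Coprime.sym p⊥q
  qqq⊥X : Coprime (q * q * q) X
  qqq⊥X = coprime-*ˡ (coprime-*ˡ q⊥X q⊥X) q⊥X
  p⊥pp+qq : Coprime p (p * p + q * q)
  p⊥pp+qq {d} (d∣p , d∣pp+qq) = coprime-*ʳ p⊥q p⊥q (d∣p , ∣m+n∣m⇒∣n d∣pp+qq (∣m⇒∣m*n p d∣p))
  from-square-root : ∀ {k} → q ≡ k * k → r * r ≡ X → ⊥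
  from-square-root {k} q≡kk rr≡X with coprime-*≡square⇒squares {w = r} p⊥pp+qq (sym rr≡X)
  ... | a , c , p≡aa , pp+qq≡cc , _ = no-primitive-solution c (a , k , a⊥k , a>0 , k>0 , quartic)
    where
    a⊥k : Coprime a k
    a⊥k = coprime-∣ˡ (divides a p≡aa) (Coprime.sym (coprime-∣ˡ (divides k q≡kk) (Coprime.sym p⊥q)))
    a>0 : a > 0
    a>0 = m*n>0⇒m>0 (subst (_> 0) p≡aa p>0)
    k>0 : k > 0
    k>0 = m*n>0⇒m>0 (subst (_> 0) q≡kk q>0)
    quartic : a * a * (a * a) + k * k * (k * k) ≡ c * c
    quartic = trans (cong₂ (λ x y → x * x + y * y) (sym p≡aa) (sym q≡kk)) pp+qq≡cc

-- The hypothesis is what ℚᵘ's _≃_ unfolds to for v² − u³ ≃ u with u = p/q, v = r/s.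
curve-equation-cleared : ∀ (p q r s : ℤ.ℤ) .{{_ : ℤ.NonZero q}} →
  (r ℤ.* r ℤ.* (q ℤ.* q ℤ.* q) ℤ.+ ℤ.- (p ℤ.* p ℤ.* p) ℤ.* (s ℤ.* s)) ℤ.* q ≡ p ℤ.* (s ℤ.* s ℤ.* (q ℤ.* q ℤ.* q)) →
  r ℤ.* r ℤ.* (q ℤ.* q ℤ.* q) ≡ s ℤ.* s ℤ.* (p ℤ.* (p ℤ.* p ℤ.+ q ℤ.* q))
curve-equation-cleared p q r s eq = ℤP.*-cancelʳ-≡ _ _ q (begin
  r ℤ.* r ℤ.* (q ℤ.* q ℤ.* q) ℤ.* q
    ≡⟨ ℤSolver.solve (p ∷ q ∷ r ∷ s ∷ []) ⟩
  (r ℤ.* r ℤ.* (q ℤ.* q ℤ.* q) ℤ.+ ℤ.- (p ℤ.* p ℤ.* p) ℤ.* (s ℤ.* s)) ℤ.* q ℤ.+ p ℤ.* p ℤ.* p ℤ.* (s ℤ.* s) ℤ.* q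
    ≡⟨ cong (ℤ._+ p ℤ.* p ℤ.* p ℤ.* (s ℤ.* s) ℤ.* q) eq ⟩
  p ℤ.* (s ℤ.* s ℤ.* (q ℤ.* q ℤ.* q)) ℤ.+ p ℤ.* p ℤ.* p ℤ.* (s ℤ.* s) ℤ.* q
    ≡⟨ ℤSolver.solve (p ∷ q ∷ s ∷ []) ⟩
  s ℤ.* s ℤ.* (p ℤ.* (p ℤ.* p ℤ.+ q ℤ.* q)) ℤ.* q
    ∎)
  where open ≡-Reasoning

i*i≡+∣i∣*∣i∣ : ∀ i → i ℤ.* i ≡ ℤ.+ (∣ i ∣ * ∣ i ∣)
i*i≡+∣i∣*∣i∣ (ℤ.+ n)    = sym (ℤP.pos-* n n)
i*i≡+∣i∣*∣i∣ ℤ.-[1+ n ] = refl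

curve-equation-abs : ∀ p r q s →
  r ℤ.* r ℤ.* (ℤ.+ q ℤ.* ℤ.+ q ℤ.* ℤ.+ q) ≡ ℤ.+ s ℤ.* ℤ.+ s ℤ.* (p ℤ.* (p ℤ.* p ℤ.+ ℤ.+ q ℤ.* ℤ.+ q)) →
  ∣ r ∣ * ∣ r ∣ * (q * q * q) ≡ s * s * (∣ p ∣ * (∣ p ∣ * ∣ p ∣ + q * q))
curve-equation-abs p r q s eq = begin
  ∣ r ∣ * ∣ r ∣ * (q * q * q)
    ≡⟨ sym (cong₂ _*_ (ℤP.abs-* r r) (trans (ℤP.abs-* (ℤ.+ q ℤ.* ℤ.+ q) (ℤ.+ q)) (cong (_* q) (ℤP.abs-* (ℤ.+ q) (ℤ.+ q))))) ⟩
  ∣ r ℤ.* r ∣ * ∣ ℤ.+ q ℤ.* ℤ.+ q ℤ.* ℤ.+ q ∣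
    ≡⟨ sym (ℤP.abs-* (r ℤ.* r) _) ⟩
  ∣ r ℤ.* r ℤ.* (ℤ.+ q ℤ.* ℤ.+ q ℤ.* ℤ.+ q) ∣
    ≡⟨ cong ∣_∣ eq ⟩
  ∣ ℤ.+ s ℤ.* ℤ.+ s ℤ.* (p ℤ.* (p ℤ.* p ℤ.+ ℤ.+ q ℤ.* ℤ.+ q)) ∣
    ≡⟨ ℤP.abs-* (ℤ.+ s ℤ.* ℤ.+ s) _ ⟩
  ∣ ℤ.+ s ℤ.* ℤ.+ s ∣ * ∣ p ℤ.* (p ℤ.* p ℤ.+ ℤ.+ q ℤ.* ℤ.+ q) ∣
    ≡⟨ cong₂ _*_ (ℤP.abs-* (ℤ.+ s) (ℤ.+ s)) (ℤP.abs-* p _) ⟩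
  s * s * (∣ p ∣ * ∣ p ℤ.* p ℤ.+ ℤ.+ q ℤ.* ℤ.+ q ∣)
    ≡⟨ cong (λ x → s * s * (∣ p ∣ * ∣ x ∣)) (cong₂ ℤ._+_ (i*i≡+∣i∣*∣i∣ p) (sym (ℤP.pos-* q q))) ⟩
  s * s * (∣ p ∣ * (∣ p ∣ * ∣ p ∣ + q * q))
    ∎
  where open ≡-Reasoning

toℚᵘ-curve : ∀ u v → v ℚ.* v ℚ.- u ℚ.* u ℚ.* u ≡ u →
             toℚᵘ v ℚᵘ.* toℚᵘ v ℚᵘ.- toℚᵘ u ℚᵘ.* toℚᵘ u ℚᵘ.* toℚᵘ u ℚᵘ.≃ toℚᵘ u
toℚᵘ-curve u v eq = ℚᵘP.≃-trans (ℚᵘP.≃-sym homo) (ℚP.toℚᵘ-cong eq)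
  where
  homo : toℚᵘ (v ℚ.* v ℚ.- u ℚ.* u ℚ.* u) ℚᵘ.≃ toℚᵘ v ℚᵘ.* toℚᵘ v ℚᵘ.- toℚᵘ u ℚᵘ.* toℚᵘ u ℚᵘ.* toℚᵘ u
  homo = ℚᵘP.≃-trans (ℚP.toℚᵘ-homo-+ (v ℚ.* v) (ℚ.- (u ℚ.* u ℚ.* u)))
    (ℚᵘP.+-cong (ℚP.toℚᵘ-homo-* v v)
      (ℚᵘP.≃-trans (ℚP.toℚᵘ-homo‿- (u ℚ.* u ℚ.* u)) (ℚᵘP.-‿cong
        (ℚᵘP.≃-trans (ℚP.toℚᵘ-homo-* (u ℚ.* u) u) (ℚᵘP.*-congʳ (ℚP.toℚᵘ-homo-* u u))))))

no-curve-point : ∀ u v → u ≢ 0ℚ → v ℚ.* v ℚ.- u ℚ.* u ℚ.* u ≢ u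
no-curve-point u@(mkℚ p q₁ p⊥q) v@(mkℚ r s₁ r⊥s) u≢0 eq with toℚᵘ-curve u v eq
... | *≡* cross = no-lowest-terms-curve-point ∣p∣>0 z<s (Coprime.recompute p⊥q) (Coprime.recompute r⊥s)
                    (curve-equation-abs p r (suc q₁) (suc s₁) (curve-equation-cleared p +[1+ q₁ ] r +[1+ s₁ ] cross))
  where
  ∣p∣>0 : ∣ p ∣ > 0
  ∣p∣>0 = >-nonZero⁻¹ ∣ p ∣ {{ℚ.≢-nonZero u≢0}}

no-twisted-curve-point : ∀ c .{{_ : ℚ.NonZero c}} u v → u ≢ 0ℚ → v ℚ.* v ℚ.- u ℚ.* u ℚ.* u ≢ c ℚ.* c ℚ.* (c ℚ.* c) ℚ.* u
no-twisted-curve-point c u v u≢0 eq = no-curve-point u′ v′ u′≢0 (begin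
  v′ ℚ.* v′ ℚ.- u′ ℚ.* u′ ℚ.* u′                     ≡⟨ scale u v c⁻¹ ⟩
  c⁻¹ ℚ.* c⁻¹ ℚ.* c⁻¹ ℚ.* (c⁻¹ ℚ.* c⁻¹ ℚ.* c⁻¹) ℚ.* (v ℚ.* v ℚ.- u ℚ.* u ℚ.* u)
                                                     ≡⟨ cong (c⁻¹ ℚ.* c⁻¹ ℚ.* c⁻¹ ℚ.* (c⁻¹ ℚ.* c⁻¹ ℚ.* c⁻¹) ℚ.*_) eq ⟩
  c⁻¹ ℚ.* c⁻¹ ℚ.* c⁻¹ ℚ.* (c⁻¹ ℚ.* c⁻¹ ℚ.* c⁻¹) ℚ.* (c ℚ.* c ℚ.* (c ℚ.* c) ℚ.* u)
                                                     ≡⟨ regroup u c c⁻¹ ⟩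
  (c⁻¹ ℚ.* c) ℚ.* (c⁻¹ ℚ.* c) ℚ.* ((c⁻¹ ℚ.* c) ℚ.* (c⁻¹ ℚ.* c)) ℚ.* u′
                                                     ≡⟨ cong (λ x → x ℚ.* x ℚ.* (x ℚ.* x) ℚ.* u′) c⁻¹c≡1 ⟩
  1ℚ ℚ.* 1ℚ ℚ.* (1ℚ ℚ.* 1ℚ) ℚ.* u′                   ≡⟨ ℚP.*-identityˡ u′ ⟩
  u′                                                 ∎)
  where
  open ≡-Reasoning
  open +-*-Solver using (_:*_; _:-_; _:=_) renaming (solve to ℚ-solve)
  c⁻¹ = 1/ c
  c⁻¹c≡1 : c⁻¹ ℚ.* c ≡ 1ℚ
  c⁻¹c≡1 = ℚP.*-inverseˡ c
  u′ = u ℚ.* (c⁻¹ ℚ.* c⁻¹)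
  v′ = v ℚ.* (c⁻¹ ℚ.* (c⁻¹ ℚ.* c⁻¹))
  scale : ∀ u v w → v ℚ.* (w ℚ.* (w ℚ.* w)) ℚ.* (v ℚ.* (w ℚ.* (w ℚ.* w)))
                    ℚ.- u ℚ.* (w ℚ.* w) ℚ.* (u ℚ.* (w ℚ.* w)) ℚ.* (u ℚ.* (w ℚ.* w))
                  ≡ w ℚ.* w ℚ.* w ℚ.* (w ℚ.* w ℚ.* w) ℚ.* (v ℚ.* v ℚ.- u ℚ.* u ℚ.* u)
  scale = ℚ-solve 3 (λ u v w → v :* (w :* (w :* w)) :* (v :* (w :* (w :* w)))
                              :- u :* (w :* w) :* (u :* (w :* w)) :* (u :* (w :* w))
                            := w :* w :* w :* (w :* w :* w) :* (v :* v :- u :* u :* u)) refl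
  regroup : ∀ u c w → w ℚ.* w ℚ.* w ℚ.* (w ℚ.* w ℚ.* w) ℚ.* (c ℚ.* c ℚ.* (c ℚ.* c) ℚ.* u)
                    ≡ (w ℚ.* c) ℚ.* (w ℚ.* c) ℚ.* ((w ℚ.* c) ℚ.* (w ℚ.* c)) ℚ.* (u ℚ.* (w ℚ.* w))
  regroup = ℚ-solve 3 (λ u c w → w :* w :* w :* (w :* w :* w) :* (c :* c :* (c :* c) :* u)
                            := (w :* c) :* (w :* c) :* ((w :* c) :* (w :* c)) :* (u :* (w :* w))) refl
  unscale : ∀ u c w → u ℚ.* ((w ℚ.* c) ℚ.* (w ℚ.* c)) ≡ u ℚ.* (w ℚ.* w) ℚ.* (c ℚ.* c)
  unscale = ℚ-solve 3 (λ u c w → u :* ((w :* c) :* (w :* c)) := u :* (w :* w) :* (c :* c)) refl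
  u′≢0 : u′ ≢ 0ℚ
  u′≢0 u′≡0 = u≢0 (begin
    u                                   ≡⟨ sym (ℚP.*-identityʳ u) ⟩
    u ℚ.* (1ℚ ℚ.* 1ℚ)                   ≡⟨ cong (λ x → u ℚ.* (x ℚ.* x)) (sym c⁻¹c≡1) ⟩
    u ℚ.* ((c⁻¹ ℚ.* c) ℚ.* (c⁻¹ ℚ.* c))     ≡⟨ unscale u c c⁻¹ ⟩
    u′ ℚ.* (c ℚ.* c)                    ≡⟨ cong (ℚ._* (c ℚ.* c)) u′≡0 ⟩
    0ℚ ℚ.* (c ℚ.* c)                    ≡⟨ ℚP.*-zeroˡ (c ℚ.* c) ⟩
    0ℚ                                  ∎)

-- Fourth powers in geometric progressions

toℚ≡mkℚ : ∀ n → toℚ n ≡ mkℚ (ℤ.+ n) 0 (λ (_ , d∣1) → ∣1⇒≡1 d∣1)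
toℚ≡mkℚ n = ℚP.normalize-coprime {n} {0} (λ (_ , d∣1) → ∣1⇒≡1 d∣1)

toℚ-* : ∀ m n → toℚ (m * n) ≡ toℚ m ℚ.* toℚ n
toℚ-* m n = trans (cong (λ i → ℚ._/_ i 1) (ℤP.pos-* m n)) (sym (cong₂ ℚ._*_ (toℚ≡mkℚ m) (toℚ≡mkℚ n)))

toℚ[1+n]≢0 : ∀ n → toℚ (suc n) ≢ 0ℚ
toℚ[1+n]≢0 n eq with trans (sym (cong ℚ.↥_ (toℚ≡mkℚ (suc n)))) (cong ℚ.↥_ eq)
... | ()

f≡⇒curve : ∀ u v (u≢0 : u ≢ 0ℚ) c → f u v u≢0 ≡ c → v ℚ.* v ℚ.- u ℚ.* u ℚ.* u ≡ c ℚ.* u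
f≡⇒curve u v u≢0 c fuv≡c = begin
  X                        ≡⟨ sym (ℚP.*-identityʳ X) ⟩
  X ℚ.* 1ℚ                 ≡⟨ cong (X ℚ.*_) (sym (ℚP.*-inverseˡ u)) ⟩
  X ℚ.* (1/ u ℚ.* u)       ≡⟨ sym (ℚP.*-assoc X (1/ u) u) ⟩
  X ℚ.* 1/ u ℚ.* u         ≡⟨ cong (ℚ._* u) fuv≡c ⟩
  c ℚ.* u                  ∎
  where
  open ≡-Reasoning
  instance
    u-nonZero : ℚ.NonZero u
    u-nonZero = ℚ.≢-nonZero u≢0
  X = v ℚ.* v ℚ.- u ℚ.* u ℚ.* u

n^4≡[n*n]*[n*n] : ∀ n → n ^ 4 ≡ n * n * (n * n)
n^4≡[n*n]*[n*n] n = trans (cong (λ x → n * (n * (n * x))) (*-identityʳ n)) (sym (*-assoc n n (n * n)))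

fourth-power∉Vf : n > 0 → ¬ InVf (toℚ (n ^ 4))
fourth-power∉Vf {n@(suc n-1)} _ (u , v , u≢0 , fuv≡n⁴) =
  no-twisted-curve-point (toℚ n) {{ℚ.≢-nonZero (toℚ[1+n]≢0 n-1)}} u v u≢0
    (trans (f≡⇒curve u v u≢0 _ fuv≡n⁴) (cong (ℚ._* u) toℚ[n⁴]))
  where
  toℚ[n⁴] : toℚ (n ^ 4) ≡ toℚ n ℚ.* toℚ n ℚ.* (toℚ n ℚ.* toℚ n)
  toℚ[n⁴] = begin
    toℚ (n ^ 4)                            ≡⟨ cong toℚ (n^4≡[n*n]*[n*n] n) ⟩
    toℚ (n * n * (n * n))                  ≡⟨ toℚ-* (n * n) (n * n) ⟩
    toℚ (n * n) ℚ.* toℚ (n * n)            ≡⟨ cong₂ ℚ._*_ (toℚ-* n n) (toℚ-* n n) ⟩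
    toℚ n ℚ.* toℚ n ℚ.* (toℚ n ℚ.* toℚ n) ∎
    where open ≡-Reasoning

[m*n]^4≡m^4*n^4 : ∀ m n → (m * n) ^ 4 ≡ m ^ 4 * n ^ 4
[m*n]^4≡m^4*n^4 m n = begin
  (m * n) ^ 4                            ≡⟨ n^4≡[n*n]*[n*n] (m * n) ⟩
  m * n * (m * n) * (m * n * (m * n))    ≡⟨ solve (m ∷ n ∷ []) ⟩
  m * m * (m * m) * (n * n * (n * n))    ≡⟨ sym (cong₂ _*_ (n^4≡[n*n]*[n*n] m) (n^4≡[n*n]*[n*n] n)) ⟩
  m ^ 4 * n ^ 4                          ∎
  where open ≡-Reasoning

fourthPowerFree-2 : FourthPowerFree 2
fourthPowerFree-2 zero 0∣2 with 0∣⇒≡0 0∣2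
... | ()
fourthPowerFree-2 1 _ = refl
fourthPowerFree-2 2 16∣2 with ∣⇒≤ 16∣2
... | s≤s (s≤s ())
fourthPowerFree-2 d@(suc (suc (suc _))) d⁴∣2 with ∣⇒≤ (∣-trans (m∣m*n {d} (d ^ 3)) d⁴∣2)
... | s≤s (s≤s ())

fourthPowerFree-part : ∀ a → a > 0 → ∃₂ λ s t → FourthPowerFree s × a ≡ s * t ^ 4
fourthPowerFree-part = <-rec _ split
  where
  split : ∀ a → (∀ {b} → b < a → b > 0 → ∃₂ λ s t → FourthPowerFree s × b ≡ s * t ^ 4) →
          a > 0 → ∃₂ λ s t → FourthPowerFree s × a ≡ s * t ^ 4
  split a@(suc _) rec _ with anyUpTo? (λ d → 2 ≤? d ×-dec d ^ 4 ∣? a) (suc a)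
  ... | yes (zero , _ , () , _)
  ... | yes (d@(suc _) , _ , 2≤d , divides m a≡md⁴) =
    let s , t , s-free , m≡st⁴ = rec m<a m>0 in s , t * d , s-free , (begin
      a                   ≡⟨ a≡md⁴ ⟩
      m * d ^ 4           ≡⟨ cong (_* d ^ 4) m≡st⁴ ⟩
      s * t ^ 4 * d ^ 4   ≡⟨ *-assoc s (t ^ 4) (d ^ 4) ⟩
      s * (t ^ 4 * d ^ 4) ≡⟨ cong (s *_) (sym ([m*n]^4≡m^4*n^4 t d)) ⟩
      s * (t * d) ^ 4     ∎)
    where
    open ≡-Reasoning
    m>0 : m > 0
    m>0 = m*n>0⇒m>0 (subst (_> 0) a≡md⁴ z<s)
    m<a : m < a
    m<a = subst (m <_) (sym a≡md⁴)
      (m<m*n m (d ^ 4) {{>-nonZero m>0}} (<-≤-trans 2≤d (m≤m*n d (d ^ 3) {{m^n≢0 d 3}})))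
  ... | no no-divisor = a , 1 , a-free , sym (*-identityʳ a)
    where
    a-free : FourthPowerFree a
    a-free zero 0∣a with 0∣⇒≡0 0∣a
    ... | ()
    a-free 1 _ = refl
    a-free d@(suc (suc _)) d⁴∣a =
      ⊥-elim (no-divisor (d , s≤s (≤-trans (m≤m*n d (d ^ 3) {{m^n≢0 d 3}}) (∣⇒≤ d⁴∣a)) , s≤s (s≤s z≤n) , d⁴∣a))

progression-meets-fourth-power :
  a > 0 → ∃ λ Q → Q ≥ 2 × FourthPowerFree Q × ∃₂ λ i c → c > 0 × a * Q ^ i ≡ c ^ 4
progression-meets-fourth-power {a} a>0 =
  let s , t , s-free , a≡st⁴ = fourthPowerFree-part a a>0
  in choose s t s-free (m*n>0⇒m>0 (m*n>0⇒n>0 {s} (subst (_> 0) a≡st⁴ a>0))) a≡st⁴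
  where
  choose : ∀ s t → FourthPowerFree s → t > 0 → a ≡ s * t ^ 4 →
           ∃ λ Q → Q ≥ 2 × FourthPowerFree Q × ∃₂ λ i c → c > 0 × a * Q ^ i ≡ c ^ 4
  choose zero t _ _ a≡0 = ⊥-elim (n>0⇒n≢0 a>0 a≡0)
  choose 1 t _ t>0 a≡t⁴ =
    2 , s≤s (s≤s z≤n) , fourthPowerFree-2 , 0 , t , t>0 , trans (*-identityʳ a) (trans a≡t⁴ (*-identityˡ (t ^ 4)))
  choose s@(suc (suc _)) t@(suc _) s-free _ a≡st⁴ = s , s≤s (s≤s z≤n) , s-free , 3 , s * t , z<s , (begin
    a * s ^ 3           ≡⟨ cong (_* s ^ 3) a≡st⁴ ⟩
    s * t ^ 4 * s ^ 3   ≡⟨ *-assoc s (t ^ 4) (s ^ 3) ⟩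
    s * (t ^ 4 * s ^ 3) ≡⟨ cong (s *_) (*-comm (t ^ 4) (s ^ 3)) ⟩
    s * (s ^ 3 * t ^ 4) ≡⟨ *-assoc s (s ^ 3) (t ^ 4) ⟨
    s ^ 4 * t ^ 4       ≡⟨ [m*n]^4≡m^4*n^4 s t ⟨
    (s * t) ^ 4         ∎)
    where open ≡-Reasoning

proposition4p5 : ¬ (∃[ a ] (a > 0 × (∀ (Q : ℕ) → Q ≥ 2 → FourthPowerFree Q → GeomInVf a Q)))
proposition4p5 (a , a>0 , G⊆Vf) =
  let Q , Q≥2 , Q-free , i , c , c>0 , aQⁱ≡c⁴ = progression-meets-fourth-power a>0
  in fourth-power∉Vf c>0 (subst (λ n → InVf (toℚ n)) aQⁱ≡c⁴ (G⊆Vf Q Q≥2 Q-free i))
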